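{- For every $n\ge1$ and all formulas $\varphi_1,\dots,\varphi_n,\psi_1,\dots,\psi_n,\alpha,\beta$: \[((\neg \varphi_{1} \rightarrow \psi_1) \land (\neg \psi_1 \rightarrow \varphi_{1}) \land \ldots \land (\neg \varphi_{n} \rightarrow \psi_n) \land (\neg \psi_n \rightarrow \varphi_{n})) \rightarrow \alpha \lor \beta \ \vdash_{\mathbf{SU}}\ (\varphi_{1} \land \ldots \land \varphi_{n} \rightarrow \alpha) \lor (\psi_1 \land \ldots \land \psi_n \rightarrow \beta).\]
   Context: Formulas are built from propositional variables and $\bot$ with $\land,\lor,\to$; $\neg\alpha$ abbreviates $\alpha\to\bot$. $\vdash_{\mathbf{SU}}$ is the consequence relation of a Hilbert system for intuitionistic propositional logic (with modus ponens) extended by all substitution instances of $\boldsymbol{su} = ((\neg p\to q)\land(\neg q\to p) \rightarrow r \vee s) \to ( p \rightarrow r) \vee(q \rightarrow s)$ as axioms. -}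

module Defs where

open import Data.Nat using (ℕ; suc)
open import Data.Vec using (Vec; []; _∷_; zipWith)
open import Relation.Binary.PropositionalEquality using (_≡_)

data Fm : Set where
  var  : ℕ → Fm
  ⊥'   : Fm
  _∧'_ : Fm → Fm → Fm
  _∨'_ : Fm → Fm → Fm
  _⇒_  : Fm → Fm → Fm

infixr 6 _∧'_
infixr 5 _∨'_
infixr 4 _⇒_

¬' : Fm → Fm
¬' a = a ⇒ ⊥'

subst : (ℕ → Fm) → Fm → Fm
subst σ (var i)  = σ i
subst σ ⊥'       = ⊥'
subst σ (a ∧' b) = subst σ a ∧' subst σ b
subst σ (a ∨' b) = subst σ a ∨' subst σ b
subst σ (a ⇒ b)  = subst σ a ⇒ subst σ b

su : Fm
su = ((¬' p ⇒ q) ∧' (¬' q ⇒ p) ⇒ r ∨' s) ⇒ (p ⇒ r) ∨' (q ⇒ s)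
  where
  p = var 0
  q = var 1
  r = var 2
  s = var 3

data IntAx : Fm → Set where
  ax-K   : ∀ a b → IntAx (a ⇒ b ⇒ a)
  ax-S   : ∀ a b c → IntAx ((a ⇒ b ⇒ c) ⇒ (a ⇒ b) ⇒ a ⇒ c)
  ax-∧E₁ : ∀ a b → IntAx (a ∧' b ⇒ a)
  ax-∧E₂ : ∀ a b → IntAx (a ∧' b ⇒ b)
  ax-∧I  : ∀ a b → IntAx (a ⇒ b ⇒ a ∧' b)
  ax-∨I₁ : ∀ a b → IntAx (a ⇒ a ∨' b)
  ax-∨I₂ : ∀ a b → IntAx (b ⇒ a ∨' b)
  ax-∨E  : ∀ a b c → IntAx ((a ⇒ c) ⇒ (b ⇒ c) ⇒ a ∨' b ⇒ c)
  ax-⊥E  : ∀ a → IntAx (⊥' ⇒ a)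

data _⊢SU_ (Γ : Fm → Set) : Fm → Set where
  hyp  : ∀ {a} → Γ a → Γ ⊢SU a
  int  : ∀ {a} → IntAx a → Γ ⊢SU a
  suAx : (σ : ℕ → Fm) → Γ ⊢SU subst σ su
  mp   : ∀ {a b} → Γ ⊢SU (a ⇒ b) → Γ ⊢SU a → Γ ⊢SU b

infix 2 _⊢SU_

⟦_⟧ : Fm → Fm → Set
⟦ a ⟧ b = a ≡ b

⋀ : ∀ {n} → Vec Fm (suc n) → Fm
⋀ (a ∷ [])     = a
⋀ (a ∷ b ∷ as) = a ∧' ⋀ (b ∷ as)

-- the conjunction (¬φ₁→ψ₁)∧(¬ψ₁→φ₁)∧…∧(¬φₙ→ψₙ)∧(¬ψₙ→φₙ)
pairClause : Fm → Fm → Fm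
pairClause φ ψ = (¬' φ ⇒ ψ) ∧' (¬' ψ ⇒ φ)

{-# OPTIONS --safe #-}
-- Instantiate su with p = ⋀ φ, q = ⋀ ψ, r = α, s = β.  Its antecedent follows
-- from the premise because pairClause is monotone in both arguments
-- (¬ a ⇒ ¬ X ⇒ Y ⇒ b whenever X ⇒ a and Y ⇒ b): the clause for the two
-- conjunctions therefore implies every componentwise clause.
module Submission where

open import Defs
open import Data.Nat using (ℕ; suc)
open import Data.Vec using (Vec; zipWith; []; _∷_)
open import Data.Sum using (_⊎_; inj₁; inj₂)
open import Relation.Binary.PropositionalEquality using (_≡_; refl)

Ctx : Set₁
Ctx = Fm → Set

_،_ : Ctx → Fm → Ctx
(Γ ، a) b = Γ b ⊎ a ≡ b

infixl 3 _،_

⊢-mono : ∀ {Γ Δ a} → (∀ {x} → Γ x → Δ x) → Γ ⊢SU a → Δ ⊢SU a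
⊢-mono f (hyp h)  = hyp (f h)
⊢-mono f (int x)  = int x
⊢-mono f (suAx σ) = suAx σ
⊢-mono f (mp d e) = mp (⊢-mono f d) (⊢-mono f e)

weaken : ∀ {Γ a b} → Γ ⊢SU b → Γ ، a ⊢SU b
weaken = ⊢-mono inj₁

here : ∀ {Γ a} → Γ ، a ⊢SU a
here = hyp (inj₂ refl)

⇒-refl : ∀ {Γ} a → Γ ⊢SU a ⇒ a
⇒-refl a = mp (mp (int (ax-S a (a ⇒ a) a)) (int (ax-K a (a ⇒ a)))) (int (ax-K a a))

⇒-const : ∀ {Γ a b} → Γ ⊢SU b → Γ ⊢SU a ⇒ b
⇒-const {a = a} {b} d = mp (int (ax-K b a)) d

deduction : ∀ {Γ a b} → Γ ، a ⊢SU b → Γ ⊢SU a ⇒ b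
deduction (hyp (inj₁ h))            = ⇒-const (hyp h)
deduction {a = a} (hyp (inj₂ refl)) = ⇒-refl a
deduction (int x)                   = ⇒-const (int x)
deduction (suAx σ)                  = ⇒-const (suAx σ)
deduction {a = a} (mp {b} {c} d e)  = mp (mp (int (ax-S a b c)) (deduction d)) (deduction e)

⇒-trans : ∀ {Γ a b c} → Γ ⊢SU a ⇒ b → Γ ⊢SU b ⇒ c → Γ ⊢SU a ⇒ c
⇒-trans f g = deduction (mp (weaken g) (mp (weaken f) here))

∧-intro : ∀ {Γ a b} → Γ ⊢SU a → Γ ⊢SU b → Γ ⊢SU a ∧' b
∧-intro {a = a} {b} d e = mp (mp (int (ax-∧I a b)) d) e

∧-elimˡ : ∀ {Γ a b} → Γ ⊢SU a ∧' b → Γ ⊢SU a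
∧-elimˡ {a = a} {b} d = mp (int (ax-∧E₁ a b)) d

∧-elimʳ : ∀ {Γ a b} → Γ ⊢SU a ∧' b → Γ ⊢SU b
∧-elimʳ {a = a} {b} d = mp (int (ax-∧E₂ a b)) d

∧-mono : ∀ {Γ a a′ b b′} → Γ ⊢SU a ⇒ a′ → Γ ⊢SU b ⇒ b′ → Γ ⊢SU a ∧' b ⇒ a′ ∧' b′
∧-mono f g = deduction (∧-intro (mp (weaken f) (∧-elimˡ here)) (mp (weaken g) (∧-elimʳ here)))

⇒-∧-intro : ∀ {Γ x a b} → Γ ⊢SU x ⇒ a → Γ ⊢SU x ⇒ b → Γ ⊢SU x ⇒ a ∧' b
⇒-∧-intro f g = deduction (∧-intro (mp (weaken f) here) (mp (weaken g) here))

⇒-mono : ∀ {Γ a a′ b b′} → Γ ⊢SU a′ ⇒ a → Γ ⊢SU b ⇒ b′ → Γ ⊢SU (a ⇒ b) ⇒ (a′ ⇒ b′)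
⇒-mono f g = deduction (deduction (mp (weaken (weaken g)) (mp (weaken here) (mp (weaken (weaken f)) here))))

contraposition : ∀ {Γ a b} → Γ ⊢SU a ⇒ b → Γ ⊢SU ¬' b ⇒ ¬' a
contraposition f = ⇒-mono f (⇒-refl ⊥')

Monotone₂ : (Fm → Fm → Fm) → Set₁
Monotone₂ _∙_ = ∀ {Γ a a′ b b′} → Γ ⊢SU a ⇒ a′ → Γ ⊢SU b ⇒ b′ → Γ ⊢SU (a ∙ b) ⇒ (a′ ∙ b′)

pairClause-mono : Monotone₂ pairClause
pairClause-mono f g = ∧-mono (⇒-mono (contraposition f) g) (⇒-mono (contraposition g) f)

⋀-zipWith : ∀ {Γ m _∙_} → Monotone₂ _∙_ → (φ ψ : Vec Fm (suc m)) →
  Γ ⊢SU (⋀ φ ∙ ⋀ ψ) ⇒ ⋀ (zipWith _∙_ φ ψ)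
⋀-zipWith ∙-mono (a ∷ [])        (b ∷ [])        = ⇒-refl _
⋀-zipWith ∙-mono (a ∷ φ@(_ ∷ _)) (b ∷ ψ@(_ ∷ _)) =
  ⇒-∧-intro (∙-mono (int (ax-∧E₁ a (⋀ φ))) (int (ax-∧E₁ b (⋀ ψ))))
            (⇒-trans (∙-mono (int (ax-∧E₂ a (⋀ φ))) (int (ax-∧E₂ b (⋀ ψ))))
                     (⋀-zipWith ∙-mono φ ψ))

su-rule : ∀ {Γ p q r s} → Γ ⊢SU pairClause p q ⇒ r ∨' s → Γ ⊢SU (p ⇒ r) ∨' (q ⇒ s)
su-rule {p = p} {q} {r} {s} = mp (suAx σ)
  where
  σ : ℕ → Fm
  σ 0 = p
  σ 1 = q
  σ 2 = r
  σ _ = s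

lemma5 : (m : ℕ) (φ ψ : Vec Fm (suc m)) (α β : Fm) →
    ⟦ ⋀ (zipWith pairClause φ ψ) ⇒ α ∨' β ⟧ ⊢SU ((⋀ φ ⇒ α) ∨' (⋀ ψ ⇒ β))
lemma5 m φ ψ α β = su-rule (⇒-trans (⋀-zipWith pairClause-mono φ ψ) (hyp refl))
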